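{- For every integer $n\geq 2$, the number of Fishburn permutations $\pi=\pi_1\cdots\pi_n$ of length $n$ that avoid both $321$ and $1243$ and satisfy $\pi_2=1$ equals $n^{2}-4n+5$.
   Context: A permutation of length $n$ is a rearrangement $\pi=\pi_1\cdots\pi_n$ of $[n]$. A permutation $\pi$ contains a classical pattern $p\in S_k$ if some subsequence of $\pi$ of length $k$ is order-isomorphic to $p$; otherwise it avoids $p$. A Fishburn permutation is a permutation $\pi$ for which there are no indices $i<j$ with $\pi_j<\pi_i<\pi_{i+1}$ and $\pi_i=\pi_j+1$. -}

module Defs where

open import Data.Nat using (ℕ; zero; suc; _<ᵇ_; _≡ᵇ_; _+_)
open import Data.Bool using (Bool; true; false; _∧_; _∨_; not)
open import Data.List using (List; []; _∷_; map; concatMap; length; filter; upTo; lookup; applyUpTo)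
open import Data.Bool using (T; T?)
open import Data.Bool.ListAction using (any; all)

-- Words are lists of values (one-line notation), positions 0-based.
-- We use 1-based values: a permutation of length n is a word whose values are
-- exactly 1..n, each occurring once.

words : ℕ → ℕ → List (List ℕ)
words k zero = [] ∷ []
words k (suc m) = concatMap (λ v → map (v ∷_) (words k m)) (applyUpTo suc k)

idx : List ℕ → List ℕ
idx w = upTo (length w)

-- value at position i (0 if out of range; never used out of range)
at : List ℕ → ℕ → ℕ
at [] _ = 0
at (x ∷ _) zero = x
at (_ ∷ xs) (suc i) = at xs i

-- π is a permutation of [n] (n = length π): every value 1..n occurs
-- (with length n over alphabet 1..n this means each occurs exactly once)
isPerm : List ℕ → Bool
isPerm w = all (λ v → any (λ x → x ≡ᵇ v) w) (applyUpTo suc (length w))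

anyPair : List ℕ → (ℕ → ℕ → Bool) → Bool
anyPair w P = any (λ i → any (λ j → (i <ᵇ j) ∧ P i j) (idx w)) (idx w)

anyTriple : List ℕ → (ℕ → ℕ → ℕ → Bool) → Bool
anyTriple w P = anyPair w (λ i j → any (λ k → (j <ᵇ k) ∧ P i j k) (idx w))

anyQuad : List ℕ → (ℕ → ℕ → ℕ → ℕ → Bool) → Bool
anyQuad w P = anyTriple w (λ i j k → any (λ l → (k <ᵇ l) ∧ P i j k l) (idx w))

contains321 : List ℕ → Bool
contains321 w = anyTriple w (λ i j k → (at w k <ᵇ at w j) ∧ (at w j <ᵇ at w i))

contains1243 : List ℕ → Bool
contains1243 w = anyQuad w (λ i j k l →
  (at w i <ᵇ at w j) ∧ (at w j <ᵇ at w l) ∧ (at w l <ᵇ at w k))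

isFishburn : List ℕ → Bool
isFishburn w = not (anyPair w (λ i j →
  ((suc i) <ᵇ length w) ∧ (at w j <ᵇ at w i) ∧ (at w i <ᵇ at w (suc i))
  ∧ (at w i ≡ᵇ (at w j + 1))))

-- π_2 = 1 (1-based position 2 = 0-based index 1)
secondIsOne : List ℕ → Bool
secondIsOne w = at w 1 ≡ᵇ 1

good : List ℕ → Bool
good w = isPerm w ∧ isFishburn w ∧ not (contains321 w) ∧ not (contains1243 w) ∧ secondIsOne w

count : ℕ → ℕ
count n = length (filter (λ w → T? (good w)) (words n n))

-- Write a good permutation as a ∷ 1 ∷ τ. Patterns through the leading a or through the 1
-- become conditions on τ alone: τ avoids 321 and 132, is Fishburn, and its entries below a
-- increase. If τ starts with some c ≥ a + 2, then c − 1 occurs later, so the Fishburn condition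
-- puts the second entry of τ below c, after which 321 and 132 force the rest of τ to increase.
-- Otherwise the entries above a increase, the entries below a increase, and no entry above a
-- lies between two entries below a, so τ = (a+1 … a+m) (2 … a−1) (a+m+1 … n). Conversely all
-- words a 1 (a+1 … a+m) (2 … a−1) (a+m+1 … n) with a ≥ 3 or (a, m) = (2, 0), and
-- a 1 c (2 … a−1) (a+1 … c−1) (c+1 … n) with c ≥ a + 2, are good. Grouped by a + m, resp. c,
-- there is one word with bound 2 and 2b − 5 words with bound b ≥ 3, so 1 + (n − 2)² in total.

module Submission where

open import Defs
open import Data.Bool using (Bool; true; false; T; T?; not)
open import Data.Bool.ListAction using (any)
open import Data.Bool.Properties using (T-∧)
open import Data.Empty using (⊥; ⊥-elim)
open import Data.List
  using (List; []; _∷_; _++_; length; map; filter; take; drop; iterate; takeWhile; applyUpTo;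
         cartesianProductWith; concatMap)
open import Data.List.Membership.Propositional using (_∈_; find; lose)
open import Data.List.Membership.Propositional.Properties
  using (∈-++⁺ˡ; ∈-++⁺ʳ; ∈-++⁻; ∈-∃++; ∈-filter⁺; ∈-filter⁻; ∈-map⁺; ∈-map⁻; ∈-upTo⁺; ∈-upTo⁻;
         ∈-applyUpTo⁺; ∈-applyUpTo⁻; ∈-cartesianProductWith⁺; ∈-cartesianProductWith⁻)
open import Data.List.Membership.Propositional.Properties.WithK using (unique∧set⇒bag)
open import Data.List.Properties
  using (∷-injective; ++-assoc; ++-identityʳ; length-++; length-map; length-iterate; map-∘;
         map-id-local; filter-accept; filter-reject; filter-all; filter-none)
open import Data.List.Relation.Binary.BagAndSetEquality using (∼bag⇒↭)
open import Data.List.Relation.Binary.Equality.Propositional using (≋⇒≡)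
open import Data.List.Relation.Binary.Permutation.Propositional
  using (_↭_; ↭-refl; ↭-sym; ↭-prep; ↭-swap; ↭⇒↭ₛ′; module PermutationReasoning)
open import Data.List.Relation.Binary.Permutation.Propositional.Properties
  using (↭-length; ∈-resp-↭; shift; shifts)
open import Data.List.Relation.Unary.All as All using (All; []; _∷_; lookup; tabulate)
open import Data.List.Relation.Unary.All.Properties using (all⁺; all⁻)
open import Data.List.Relation.Unary.AllPairs as AllPairs using (AllPairs; []; _∷_)
import Data.List.Relation.Unary.AllPairs.Properties as AllPairsₚ
open import Data.List.Relation.Unary.Any using (Any; here; there)
open import Data.List.Relation.Unary.Any.Properties using (any⁺; any⁻)
open import Data.List.Relation.Unary.Linked.Properties using (AllPairs⇒Linked)
open import Data.List.Relation.Unary.Sorted.TotalOrder.Properties using (↗↭↗⇒≋)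
open import Data.List.Relation.Unary.Unique.Propositional using (Unique)
import Data.List.Relation.Unary.Unique.Propositional.Properties as Unique
open import Data.Nat
  using (ℕ; zero; suc; _+_; _*_; _∸_; _≤_; _<_; z≤n; s≤s; _<ᵇ_; _≡ᵇ_; _≟_; _≤?_; _<?_)
open import Data.Nat.Properties
open import Data.Nat.Tactic.RingSolver using (solve-∀)
open import Data.Product using (∃-syntax; _×_; _,_; proj₁; proj₂)
open import Data.Sum using (_⊎_; inj₁; inj₂)
open import Function using (_∘_)
open import Function.Bundles using (Equivalence; mk⇔)
open import Relation.Binary.Definitions using (tri<; tri≈; tri>)
open import Relation.Binary.PropositionalEquality
  using (_≡_; _≢_; refl; sym; trans; cong; cong₂; subst; ≢-sym; isEquivalence; module ≡-Reasoning)
open import Relation.Nullary using (¬_; Dec; yes; no; contradiction)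
open import Relation.Unary using (Decidable; ∁)
open import Relation.Unary.Properties using (∁?)

open Equivalence using (to; from)

IsPermutation : List ℕ → Set
IsPermutation w = ∀ {v} → 1 ≤ v → v ≤ length w → v ∈ w

Avoids321 : List ℕ → Set
Avoids321 w = ∀ {i j k} → i < j → j < k → k < length w →
  at w k < at w j → at w j < at w i → ⊥

Avoids1243 : List ℕ → Set
Avoids1243 w = ∀ {i j k l} → i < j → j < k → k < l → l < length w →
  at w i < at w j → at w j < at w l → at w l < at w k → ⊥

IsFishburn : List ℕ → Set
IsFishburn w = ∀ {i j} → i < j → j < length w →
  at w i < at w (suc i) → at w i ≡ at w j + 1 → ⊥

record Good (w : List ℕ) : Set where
  field
    permutation : IsPermutation w
    fishburn    : IsFishburn w
    avoids321   : Avoids321 w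
    avoids1243  : Avoids1243 w
    second≡1    : at w 1 ≡ 1

any-idx⁻ : ∀ w (p : ℕ → Bool) → T (any p (idx w)) → ∃[ i ] i < length w × T (p i)
any-idx⁻ w p h = let i , i∈ , pi = find (any⁻ p (idx w) h) in i , ∈-upTo⁻ i∈ , pi

any-idx⁺ : ∀ w (p : ℕ → Bool) {i} → i < length w → T (p i) → T (any p (idx w))
any-idx⁺ w p i< pi = any⁺ p (lose (∈-upTo⁺ i<) pi)

anyPair⁻ : ∀ w P → T (anyPair w P) → ∃[ i ] ∃[ j ] i < j × j < length w × T (P i j)
anyPair⁻ w P h =
  let i , _ , h₁  = any-idx⁻ w _ h
      j , j< , h₂ = any-idx⁻ w _ h₁
      i<ᵇj , Pij  = to (T-∧ {i <ᵇ j}) h₂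
  in i , j , <ᵇ⇒< i j i<ᵇj , j< , Pij

anyPair⁺ : ∀ w P {i j} → i < j → j < length w → T (P i j) → T (anyPair w P)
anyPair⁺ w P i<j j< Pij =
  any-idx⁺ w _ (<-trans i<j j<) (any-idx⁺ w _ j< (from T-∧ (<⇒<ᵇ i<j , Pij)))

anyTriple⁻ : ∀ w P → T (anyTriple w P) →
  ∃[ i ] ∃[ j ] ∃[ k ] i < j × j < k × k < length w × T (P i j k)
anyTriple⁻ w P h =
  let i , j , i<j , _ , h₁ = anyPair⁻ w _ h
      k , k< , h₂          = any-idx⁻ w _ h₁
      j<ᵇk , Pijk          = to (T-∧ {j <ᵇ k}) h₂
  in i , j , k , i<j , <ᵇ⇒< j k j<ᵇk , k< , Pijk

anyTriple⁺ : ∀ w P {i j k} → i < j → j < k → k < length w → T (P i j k) → T (anyTriple w P)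
anyTriple⁺ w P i<j j<k k< Pijk =
  anyPair⁺ w _ i<j (<-trans j<k k<) (any-idx⁺ w _ k< (from T-∧ (<⇒<ᵇ j<k , Pijk)))

anyQuad⁻ : ∀ w P → T (anyQuad w P) →
  ∃[ i ] ∃[ j ] ∃[ k ] ∃[ l ] i < j × j < k × k < l × l < length w × T (P i j k l)
anyQuad⁻ w P h =
  let i , j , k , i<j , j<k , _ , h₁ = anyTriple⁻ w _ h
      l , l< , h₂                    = any-idx⁻ w _ h₁
      k<ᵇl , Pijkl                   = to (T-∧ {k <ᵇ l}) h₂
  in i , j , k , l , i<j , j<k , <ᵇ⇒< k l k<ᵇl , l< , Pijkl

anyQuad⁺ : ∀ w P {i j k l} → i < j → j < k → k < l → l < length w → T (P i j k l) →
  T (anyQuad w P)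
anyQuad⁺ w P i<j j<k k<l l< Pijkl =
  anyTriple⁺ w _ i<j j<k (<-trans k<l l<) (any-idx⁺ w _ l< (from T-∧ (<⇒<ᵇ k<l , Pijkl)))

T-not⁻ : ∀ {b} → T (not b) → ¬ T b
T-not⁻ {false} _ ()

T-not⁺ : ∀ {b} → ¬ T b → T (not b)
T-not⁺ {true}  ¬b = ¬b _
T-not⁺ {false} _  = _

isPerm⁻ : ∀ w → T (isPerm w) → IsPermutation w
isPerm⁻ w h {suc i} _ i< =
  let x , x∈ , x≡ᵇ = find (any⁻ _ w (lookup (all⁺ _ _ h) (∈-applyUpTo⁺ suc i<)))
  in subst (_∈ w) (≡ᵇ⇒≡ x (suc i) x≡ᵇ) x∈

isPerm⁺ : ∀ w → IsPermutation w → T (isPerm w)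
isPerm⁺ w perm = all⁻ _ (tabulate λ v∈ → occurs (∈-applyUpTo⁻ suc v∈))
  where
  occurs : ∀ {v} → ∃[ i ] i < length w × v ≡ suc i → T (any (λ x → x ≡ᵇ v) w)
  occurs (i , i< , refl) = any⁺ _ (lose (perm (s≤s z≤n) i<) (≡⇒≡ᵇ (suc i) (suc i) refl))

good⇒Good : ∀ w → T (good w) → Good w
good⇒Good w h =
  let perm , h₁       = to (T-∧ {isPerm w}) h
      fish , h₂       = to (T-∧ {isFishburn w}) h₁
      no321 , h₃      = to (T-∧ {not (contains321 w)}) h₂
      no1243 , second = to (T-∧ {not (contains1243 w)}) h₃
  in record
  { permutation = isPerm⁻ w perm
  ; fishburn    = λ i<j j< asc eq → T-not⁻ fish (anyPair⁺ w _ i<j j<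
      (from T-∧ (<⇒<ᵇ (≤-<-trans i<j j<) , from T-∧ (<⇒<ᵇ (descent eq) ,
        from T-∧ (<⇒<ᵇ asc , ≡⇒≡ᵇ _ _ eq)))))
  ; avoids321   = λ i<j j<k k< c<b b<a → T-not⁻ no321 (anyTriple⁺ w _ i<j j<k k<
      (from T-∧ (<⇒<ᵇ c<b , <⇒<ᵇ b<a)))
  ; avoids1243  = λ i<j j<k k<l l< a<b b<d d<c → T-not⁻ no1243 (anyQuad⁺ w _ i<j j<k k<l l<
      (from T-∧ (<⇒<ᵇ a<b , from T-∧ (<⇒<ᵇ b<d , <⇒<ᵇ d<c))))
  ; second≡1    = ≡ᵇ⇒≡ _ _ second
  }
  where
  descent : ∀ {x y} → x ≡ y + 1 → y < x
  descent {y = y} refl = m<m+n y (s≤s z≤n)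

Good⇒good : ∀ w → Good w → T (good w)
Good⇒good w g = from T-∧ (isPerm⁺ w permutation , from T-∧ (T-not⁺ fishburn-pattern ,
  from T-∧ (T-not⁺ pattern321 , from T-∧ (T-not⁺ pattern1243 , ≡⇒≡ᵇ _ _ second≡1))))
  where
  open Good g
  fishburn-pattern : ¬ T (anyPair w _)
  fishburn-pattern h =
    let i , j , i<j , j< , h₁ = anyPair⁻ w _ h
        _ , h₂   = to (T-∧ {suc i <ᵇ length w}) h₁
        _ , h₃   = to (T-∧ {at w j <ᵇ at w i}) h₂
        asc , eq = to (T-∧ {at w i <ᵇ at w (suc i)}) h₃
    in fishburn i<j j< (<ᵇ⇒< _ _ asc) (≡ᵇ⇒≡ _ _ eq)
  pattern321 : ¬ T (contains321 w)
  pattern321 h =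
    let i , j , k , i<j , j<k , k< , h₁ = anyTriple⁻ w _ h
        c<b , b<a = to (T-∧ {at w k <ᵇ at w j}) h₁
    in avoids321 i<j j<k k< (<ᵇ⇒< _ _ c<b) (<ᵇ⇒< _ _ b<a)
  pattern1243 : ¬ T (contains1243 w)
  pattern1243 h =
    let i , j , k , l , i<j , j<k , k<l , l< , h₁ = anyQuad⁻ w _ h
        a<b , h₂  = to (T-∧ {at w i <ᵇ at w j}) h₁
        b<d , d<c = to (T-∧ {at w j <ᵇ at w l}) h₂
    in avoids1243 i<j j<k k<l l< (<ᵇ⇒< _ _ a<b) (<ᵇ⇒< _ _ b<d) (<ᵇ⇒< _ _ d<c)

concatMap-map≡cartesianProductWith : ∀ {A B C : Set} (f : A → B → C) xs ys →
  concatMap (λ x → map (f x) ys) xs ≡ cartesianProductWith f xs ys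
concatMap-map≡cartesianProductWith f []       ys = refl
concatMap-map≡cartesianProductWith f (x ∷ xs) ys =
  cong (map (f x) ys ++_) (concatMap-map≡cartesianProductWith f xs ys)

words-suc : ∀ k m → words k (suc m) ≡ cartesianProductWith _∷_ (applyUpTo suc k) (words k m)
words-suc k m = concatMap-map≡cartesianProductWith _∷_ (applyUpTo suc k) (words k m)

∈-words⁻ : ∀ k m {w} → w ∈ words k m → length w ≡ m × All (_∈ applyUpTo suc k) w
∈-words⁻ k zero    (here refl) = refl , []
∈-words⁻ k (suc m) w∈ rewrite words-suc k m =
  let v , u , v∈ , u∈ , w≡ = ∈-cartesianProductWith⁻ _∷_ _ _ w∈
      |u| , letters        = ∈-words⁻ k m u∈
  in subst (λ w → length w ≡ suc m × All (_∈ applyUpTo suc k) w) (sym w≡)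
       (cong suc |u| , v∈ ∷ letters)

∈-words⁺ : ∀ k m {w} → length w ≡ m → All (_∈ applyUpTo suc k) w → w ∈ words k m
∈-words⁺ k zero    {[]}    refl []            = here refl
∈-words⁺ k (suc m) {v ∷ w} |w| (v∈ ∷ letters) rewrite words-suc k m =
  ∈-cartesianProductWith⁺ _∷_ v∈ (∈-words⁺ k m (suc-injective |w|) letters)

words-unique : ∀ k m → Unique (words k m)
words-unique k zero    = [] ∷ []
words-unique k (suc m) rewrite words-suc k m =
  Unique.cartesianProductWith⁺ _∷_ ∷-injective
    (Unique.applyUpTo⁺₁ suc k (λ i<j _ → <⇒≢ i<j ∘ suc-injective)) (words-unique k m)

interval : ℕ → ℕ → List ℕ
interval s e = iterate suc s (e ∸ s)

length-interval : ∀ s e → length (interval s e) ≡ e ∸ s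
length-interval s e = length-iterate suc s (e ∸ s)

∈-iterate-suc⁻ : ∀ s k {x} → x ∈ iterate suc s k → s ≤ x × x < s + k
∈-iterate-suc⁻ s (suc k) (here refl) = ≤-refl , m<m+n s (s≤s z≤n)
∈-iterate-suc⁻ s (suc k) (there x∈) =
  let s<x , x< = ∈-iterate-suc⁻ (suc s) k x∈ in <⇒≤ s<x , subst (_<_ _) (sym (+-suc s k)) x<

∈-iterate-suc⁺ : ∀ s k {x} → s ≤ x → x < s + k → x ∈ iterate suc s k
∈-iterate-suc⁺ s zero    s≤x x< = ⊥-elim (<⇒≱ x< (subst (_≤ _) (sym (+-identityʳ s)) s≤x))
∈-iterate-suc⁺ s (suc k) s≤x x< with m≤n⇒m<n∨m≡n s≤x
... | inj₂ refl = here refl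
... | inj₁ s<x  = there (∈-iterate-suc⁺ (suc s) k s<x (subst (_<_ _) (+-suc s k) x<))

∈-interval⁻ : ∀ s e {x} → x ∈ interval s e → s ≤ x × x < e
∈-interval⁻ s e x∈ with s≤x , x< ← ∈-iterate-suc⁻ s (e ∸ s) x∈ with s ≤? e
... | yes s≤e = s≤x , subst (_<_ _) (m+[n∸m]≡n s≤e) x<
... | no  s≰e = ⊥-elim (<⇒≱ x< (subst (_≤ _) (sym s+[e∸s]≡s) s≤x))
  where
  s+[e∸s]≡s : s + (e ∸ s) ≡ s
  s+[e∸s]≡s = trans (cong (s +_) (m≤n⇒m∸n≡0 (<⇒≤ (≰⇒> s≰e)))) (+-identityʳ s)

∈-interval⁺ : ∀ {s e x} → s ≤ x → x < e → x ∈ interval s e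
∈-interval⁺ {s} {e} s≤x x<e =
  ∈-iterate-suc⁺ s (e ∸ s) s≤x (subst (_<_ _) (sym (m+[n∸m]≡n (≤-trans s≤x (<⇒≤ x<e)))) x<e)

iterate-suc-++ : ∀ s k l → iterate suc s k ++ iterate suc (s + k) l ≡ iterate suc s (k + l)
iterate-suc-++ s zero    l = cong (λ t → iterate suc t l) (+-identityʳ s)
iterate-suc-++ s (suc k) l =
  cong (s ∷_) (trans (cong (λ t → iterate suc (suc s) k ++ iterate suc t l) (+-suc s k))
                     (iterate-suc-++ (suc s) k l))

interval-++ : ∀ {s t e} → s ≤ t → t ≤ e → interval s t ++ interval t e ≡ interval s e
interval-++ {s} {t} {e} s≤t t≤e = trans
  (cong (λ u → interval s t ++ iterate suc u (e ∸ t)) (sym (m+[n∸m]≡n s≤t)))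
  (trans (iterate-suc-++ s (t ∸ s) (e ∸ t)) (cong (iterate suc s) lengths))
  where
  open ≡-Reasoning
  lengths : (t ∸ s) + (e ∸ t) ≡ e ∸ s
  lengths = +-cancelˡ-≡ s _ _ (begin
    s + ((t ∸ s) + (e ∸ t)) ≡⟨ sym (+-assoc s _ _) ⟩
    (s + (t ∸ s)) + (e ∸ t) ≡⟨ cong (_+ (e ∸ t)) (m+[n∸m]≡n s≤t) ⟩
    t + (e ∸ t)             ≡⟨ m+[n∸m]≡n t≤e ⟩
    e                       ≡⟨ sym (m+[n∸m]≡n (≤-trans s≤t t≤e)) ⟩
    s + (e ∸ s)             ∎)

interval-∷ : ∀ {s e} → s < e → interval s e ≡ s ∷ interval (suc s) e
interval-∷ {s} {suc e} (s≤s s≤e) = cong (iterate suc s) (+-∸-assoc 1 s≤e)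

interval-+ : ∀ s m → interval s (s + m) ≡ iterate suc s m
interval-+ s m = cong (iterate suc s) (m+n∸m≡n s m)

interval-AllPairs : ∀ {R : ℕ → ℕ → Set} s e → (∀ {x y} → s ≤ x → x < y → y < e → R x y) →
  AllPairs R (interval s e)
interval-AllPairs {R} s e R-between = go s (e ∸ s) ≤-refl (λ y∈ → proj₂ (∈-interval⁻ s e y∈))
  where
  go : ∀ t k → s ≤ t → (∀ {y} → y ∈ iterate suc t k → y < e) → AllPairs R (iterate suc t k)
  go t zero    _   _  = []
  go t (suc k) s≤t <e =
    tabulate (λ y∈ → R-between s≤t (proj₁ (∈-iterate-suc⁻ (suc t) k y∈)) (<e (there y∈))) ∷
    go (suc t) k (m≤n⇒m≤1+n s≤t) (λ y∈ → <e (there y∈))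

interval-increasing : ∀ s e → AllPairs _<_ (interval s e)
interval-increasing s e = interval-AllPairs s e (λ _ x<y _ → x<y)

at-∈ : ∀ w {i} → i < length w → at w i ∈ w
at-∈ (x ∷ w) {zero}  _        = here refl
at-∈ (x ∷ w) {suc i} (s≤s i<) = there (at-∈ w i<)

∈⇒at : ∀ {w x} → x ∈ w → ∃[ i ] i < length w × at w i ≡ x
∈⇒at (here refl) = 0 , s≤s z≤n , refl
∈⇒at (there x∈)  = let i , i< , eq = ∈⇒at x∈ in suc i , s≤s i< , eq

AllPairs⇒at : ∀ {R : ℕ → ℕ → Set} {xs} → AllPairs R xs →
  ∀ {i j} → i < j → j < length xs → R (at xs i) (at xs j)
AllPairs⇒at (Rx ∷ _)   {zero}  {suc j} _         (s≤s j<) = lookup Rx (at-∈ _ j<)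
AllPairs⇒at (_  ∷ Rxs) {suc i} {suc j} (s≤s i<j) (s≤s j<) = AllPairs⇒at Rxs i<j j<

at⇒AllPairs : ∀ {R : ℕ → ℕ → Set} xs →
  (∀ {i j} → i < j → j < length xs → R (at xs i) (at xs j)) → AllPairs R xs
at⇒AllPairs     []       _    = []
at⇒AllPairs {R} (x ∷ xs) R-at =
  tabulate (λ y∈ → let j , j< , x≡ = ∈⇒at y∈ in subst (R x) x≡ (R-at (s≤s z≤n) (s≤s j<))) ∷
  at⇒AllPairs xs (λ i<j j< → R-at (s≤s i<j) (s≤s j<))

at⇒All : ∀ {Q : ℕ → Set} xs → (∀ {j} → j < length xs → Q (at xs j)) → All Q xs
at⇒All []       _    = []
at⇒All (x ∷ xs) Q-at = Q-at (s≤s z≤n) ∷ at⇒All xs (λ j< → Q-at (s≤s j<))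

AllPairs-++ : ∀ {R : ℕ → ℕ → Set} {xs ys} → AllPairs R xs → AllPairs R ys →
  (∀ {x y} → x ∈ xs → y ∈ ys → R x y) → AllPairs R (xs ++ ys)
AllPairs-++ Rxs Rys R-across =
  AllPairsₚ.++⁺ Rxs Rys (tabulate λ x∈ → tabulate λ y∈ → R-across x∈ y∈)

↭-of-same-elements : ∀ {A : Set} {xs ys : List A} → Unique xs → Unique ys →
  (∀ {x} → x ∈ xs → x ∈ ys) → (∀ {x} → x ∈ ys → x ∈ xs) → xs ↭ ys
↭-of-same-elements xs! ys! to from = ∼bag⇒↭ (unique∧set⇒bag xs! ys! (mk⇔ to from))

increasing-unique : ∀ {xs} → AllPairs _<_ xs → Unique xs
increasing-unique = AllPairs.map <⇒≢

increasing-≡ : ∀ {xs ys} → AllPairs _<_ xs → AllPairs _<_ ys →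
  (∀ {x} → x ∈ xs → x ∈ ys) → (∀ {x} → x ∈ ys → x ∈ xs) → xs ≡ ys
increasing-≡ xs↑ ys↑ to from = ≋⇒≡ (↗↭↗⇒≋ ≤-totalOrder
  (AllPairs⇒Linked (AllPairs.map <⇒≤ xs↑)) (AllPairs⇒Linked (AllPairs.map <⇒≤ ys↑))
  (↭⇒↭ₛ′ isEquivalence (↭-of-same-elements (increasing-unique xs↑) (increasing-unique ys↑) to from)))

++-injective-length : ∀ {xs ys us vs : List ℕ} → length xs ≡ length us →
  xs ++ ys ≡ us ++ vs → xs ≡ us × ys ≡ vs
++-injective-length {[]}     {us = []}     _     eq = refl , eq
++-injective-length {x ∷ xs} {us = u ∷ us} |xs|≡ eq =
  let x≡u , eq′ = ∷-injective eq
      xs≡ , ys≡ = ++-injective-length (suc-injective |xs|≡) eq′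
  in cong₂ _∷_ x≡u xs≡ , ys≡

module _ {P : ℕ → Set} (P? : Decidable P) where

  filter-increasing : ∀ xs →
    (∀ {i j} → i < j → j < length xs → P (at xs i) → P (at xs j) → at xs i < at xs j) →
    AllPairs _<_ (filter P? xs)
  filter-increasing []       _ = []
  filter-increasing (x ∷ xs) ↑ = go (P? x)
    where
    rest↑ : AllPairs _<_ (filter P? xs)
    rest↑ = filter-increasing xs (λ i<j j< → ↑ (s≤s i<j) (s≤s j<))
    go : Dec (P x) → AllPairs _<_ (filter P? (x ∷ xs))
    go (yes px) rewrite filter-accept P? {x} {xs} px = tabulate x<y ∷ rest↑
      where
      x<y : ∀ {y} → y ∈ filter P? xs → x < y
      x<y y∈ = let y∈xs , py = ∈-filter⁻ P? {xs = xs} y∈ ; j , j< , y≡ = ∈⇒at y∈xs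
               in subst (x <_) y≡ (↑ (s≤s z≤n) (s≤s j<) px (subst P (sym y≡) py))
    go (no ¬px) rewrite filter-reject P? {x} {xs} ¬px = rest↑

  partition-≡ : ∀ xs →
    (∀ {i j} → i < j → j < length xs → ¬ P (at xs i) → P (at xs j) → ⊥) →
    xs ≡ filter P? xs ++ filter (∁? P?) xs
  partition-≡ []       _       = refl
  partition-≡ (x ∷ xs) no-∁P-P = go (P? x)
    where
    all-∁P : ¬ P x → All (∁ P) xs
    all-∁P ¬px = at⇒All xs (λ j< → no-∁P-P (s≤s z≤n) (s≤s j<) ¬px)
    go : Dec (P x) → x ∷ xs ≡ filter P? (x ∷ xs) ++ filter (∁? P?) (x ∷ xs)
    go (yes px) rewrite filter-accept P? {x} {xs} px
                      | filter-reject (∁? P?) {x} {xs} (λ ¬px → ¬px px) =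
      cong (x ∷_) (partition-≡ xs (λ i<j j< → no-∁P-P (s≤s i<j) (s≤s j<)))
    go (no ¬px) rewrite filter-reject P? {x} {xs} ¬px | filter-accept (∁? P?) {x} {xs} ¬px
                      | filter-none P? (all-∁P ¬px) | filter-all (∁? P?) (all-∁P ¬px) = refl

  partition-sandwich : ∀ xs →
    (∀ {i j k} → i < j → j < k → k < length xs → P (at xs i) → ¬ P (at xs j) → P (at xs k) → ⊥) →
    ∃[ X ] ∃[ Z ] xs ≡ X ++ filter P? xs ++ Z × X ++ Z ≡ filter (∁? P?) xs
  partition-sandwich []       _          = [] , [] , refl , refl
  partition-sandwich (x ∷ xs) no-P-∁P-P = go (P? x)
    where
    go : Dec (P x) →
      ∃[ X ] ∃[ Z ] x ∷ xs ≡ X ++ filter P? (x ∷ xs) ++ Z × X ++ Z ≡ filter (∁? P?) (x ∷ xs)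
    go (yes px) rewrite filter-accept P? {x} {xs} px
                      | filter-reject (∁? P?) {x} {xs} (λ ¬px → ¬px px) =
      [] , filter (∁? P?) xs ,
      cong (x ∷_) (partition-≡ xs (λ i<j j< → no-P-∁P-P (s≤s z≤n) (s≤s i<j) (s≤s j<) px)) , refl
    go (no ¬px) rewrite filter-reject P? {x} {xs} ¬px | filter-accept (∁? P?) {x} {xs} ¬px =
      let X , Z , xs≡ , XZ≡ =
            partition-sandwich xs (λ i<j j<k k< → no-P-∁P-P (s≤s i<j) (s≤s j<k) (s≤s k<))
      in x ∷ X , Z , cong (x ∷_) xs≡ , cong (x ∷_) XZ≡

  takeWhile-++ : ∀ {xs} ys → All P xs → takeWhile P? (xs ++ ys) ≡ xs ++ takeWhile P? ys
  takeWhile-++ ys []               = refl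
  takeWhile-++ ys (_∷_ {x} px pxs) with P? x
  ... | yes _   = cong (x ∷_) (takeWhile-++ ys pxs)
  ... | no  ¬px = contradiction px ¬px

  takeWhile-reject : ∀ {y} ys → ¬ P y → takeWhile P? (y ∷ ys) ≡ []
  takeWhile-reject {y} ys ¬py with P? y
  ... | yes py = contradiction py ¬py
  ... | no  _  = refl

pigeonhole : ∀ {xs ys : List ℕ} → Unique xs → (∀ {x} → x ∈ xs → x ∈ ys) → length xs ≤ length ys
pigeonhole {[]}     _            _   = z≤n
pigeonhole {x ∷ xs} (x∉xs ∷ xs!) xs⊆ with p , q , refl ← ∈-∃++ (xs⊆ (here refl)) =
  subst (length (x ∷ xs) ≤_) (sym (↭-length (shift x p q))) (s≤s (pigeonhole xs! xs⊆p++q))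
  where
  xs⊆p++q : ∀ {y} → y ∈ xs → y ∈ p ++ q
  xs⊆p++q {y} y∈ with ∈-++⁻ p (xs⊆ (there y∈))
  ... | inj₁ y∈p         = ∈-++⁺ˡ y∈p
  ... | inj₂ (here y≡x)  = ⊥-elim (lookup x∉xs y∈ (sym y≡x))
  ... | inj₂ (there y∈q) = ∈-++⁺ʳ p y∈q

split-at : ∀ ys {j} → j < length ys → ys ≡ take j ys ++ at ys j ∷ drop (suc j) ys
split-at (y ∷ ys) {zero}  _        = refl
split-at (y ∷ ys) {suc j} (s≤s j<) = cong (y ∷_) (split-at ys j<)

at-∈-take : ∀ ys {i j} → i < j → j < length ys → at ys i ∈ take j ys
at-∈-take (y ∷ ys) {zero}  {suc j} _         _        = here refl
at-∈-take (y ∷ ys) {suc i} {suc j} (s≤s i<j) (s≤s j<) = there (at-∈-take ys i<j j<)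

-- Deleting the entry at j loses no element of xs, against the pigeonhole bound.
covering-distinct : ∀ {xs ys : List ℕ} → Unique xs → (∀ {x} → x ∈ xs → x ∈ ys) →
  length ys ≤ length xs → ∀ {i j} → i < j → j < length ys → at ys i ≢ at ys j
covering-distinct {xs} {ys} xs! xs⊆ys |ys|≤ {i} {j} i<j j< yi≡yj =
  <⇒≱ |ys′|<|xs| (pigeonhole xs! xs⊆ys′)
  where
  ys′ : List ℕ
  ys′ = take j ys ++ drop (suc j) ys
  |ys′|<|xs| : length ys′ < length xs
  |ys′|<|xs| = ≤-trans (≤-reflexive (trans (sym (↭-length (shift (at ys j) (take j ys) _)))
                                          (cong length (sym (split-at ys j<)))))
                       |ys|≤
  xs⊆ys′ : ∀ {x} → x ∈ xs → x ∈ ys′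
  xs⊆ys′ x∈ with ∈-++⁻ (take j ys) (subst (_ ∈_) (split-at ys j<) (xs⊆ys x∈))
  ... | inj₁ x∈take         = ∈-++⁺ˡ x∈take
  ... | inj₂ (here refl)    = ∈-++⁺ˡ (subst (_∈ take j ys) yi≡yj (at-∈-take ys i<j j<))
  ... | inj₂ (there x∈drop) = ∈-++⁺ʳ (take j ys) x∈drop

-- Patterns in a ∷ 1 ∷ τ

Avoids132 : List ℕ → Set
Avoids132 u = ∀ {i j k} → i < j → j < k → k < length u →
  at u i < at u k → at u k < at u j → ⊥

Avoids21Below : ℕ → List ℕ → Set
Avoids21Below a u = ∀ {i j} → i < j → j < length u → at u j < at u i → at u i < a → ⊥

Positive : List ℕ → Set
Positive u = ∀ {t} → t < length u → 0 < at u t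

-- A 321 through the leading a is a 21 below a in τ, and a 1243 through the 1 is a 132 in τ.
record Admissible (a : ℕ) (τ : List ℕ) : Set where
  field
    avoids321     : Avoids321 τ
    avoids21Below : Avoids21Below a τ
    avoids132     : Avoids132 τ
    fishburn      : IsFishburn τ

module _ {a τ} (pos : Positive (a ∷ 1 ∷ τ)) (adm : Admissible a τ) where
  open Admissible adm

  avoids321-∷∷ : Avoids321 (a ∷ 1 ∷ τ)
  avoids321-∷∷ {zero}        {suc zero}    {suc (suc k)} _ _ k< c<1 _ = <⇒≱ c<1 (pos k<)
  avoids321-∷∷ {zero}        {suc (suc j)} {suc (suc k)} _ (s≤s (s≤s j<k)) (s≤s (s≤s k<)) =
    avoids21Below j<k k<
  avoids321-∷∷ {suc zero}    {suc (suc j)} {suc (suc k)} _ _ k< c<b b<1 =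
    <⇒≱ (<-trans c<b b<1) (pos k<)
  avoids321-∷∷ {suc (suc i)} {suc (suc j)} {suc (suc k)}
    (s≤s (s≤s i<j)) (s≤s (s≤s j<k)) (s≤s (s≤s k<)) = avoids321 i<j j<k k<
  avoids321-∷∷ {zero}     {suc zero}    {suc zero} _ (s≤s ())
  avoids321-∷∷ {suc zero} {suc zero}                 (s≤s ())
  avoids321-∷∷ {suc zero} {suc (suc j)} {suc zero} _ (s≤s ())

  avoids1243-∷∷ : Avoids1243 (a ∷ 1 ∷ τ)
  avoids1243-∷∷ {zero} {suc zero} _ _ _ _ a<1 _ _ = <⇒≱ a<1 (pos (s≤s z≤n))
  avoids1243-∷∷ {zero}        {suc (suc j)} {suc (suc k)} {suc (suc l)}
    _ (s≤s (s≤s j<k)) (s≤s (s≤s k<l)) (s≤s (s≤s l<)) _ = avoids132 j<k k<l l<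
  avoids1243-∷∷ {suc zero}    {suc (suc j)} {suc (suc k)} {suc (suc l)}
    _ (s≤s (s≤s j<k)) (s≤s (s≤s k<l)) (s≤s (s≤s l<)) _ = avoids132 j<k k<l l<
  avoids1243-∷∷ {suc (suc i)} {suc (suc j)} {suc (suc k)} {suc (suc l)}
    _ (s≤s (s≤s j<k)) (s≤s (s≤s k<l)) (s≤s (s≤s l<)) _ = avoids132 j<k k<l l<
  avoids1243-∷∷ {suc zero}    {suc zero} (s≤s ())
  avoids1243-∷∷ {suc (suc i)} {suc zero} (s≤s ())

  fishburn-∷∷ : IsFishburn (a ∷ 1 ∷ τ)
  fishburn-∷∷ {zero} {j} _ _ a<1 a≡ = <⇒≱ (subst (_< 1) a≡ a<1) (m≤n+m 1 (at (a ∷ 1 ∷ τ) j))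
  fishburn-∷∷ {suc zero} {suc (suc j)} _ j< _ 1≡ =
    <⇒≢ (pos j<) (suc-injective (trans 1≡ (+-comm _ 1)))
  fishburn-∷∷ {suc (suc i)} {suc (suc j)} (s≤s (s≤s i<j)) (s≤s (s≤s j<)) = fishburn i<j j<
  fishburn-∷∷ {suc zero} {suc zero} (s≤s ())

admissible-tail : ∀ {a τ} → (∀ {t} → t < length τ → 1 < at τ t) →
  Avoids321 (a ∷ 1 ∷ τ) → Avoids1243 (a ∷ 1 ∷ τ) → IsFishburn (a ∷ 1 ∷ τ) → Admissible a τ
admissible-tail >1 no321 no1243 fish = record
  { avoids321     = λ i<j j<k k< → no321 (s≤s (s≤s i<j)) (s≤s (s≤s j<k)) (s≤s (s≤s k<))
  ; avoids21Below = λ i<j j< → no321 {0} (s≤s z≤n) (s≤s (s≤s i<j)) (s≤s (s≤s j<))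
  ; avoids132     = λ i<j j<k k< → no1243 {1} (s≤s (s≤s z≤n)) (s≤s (s≤s i<j)) (s≤s (s≤s j<k))
                                     (s≤s (s≤s k<)) (>1 (<-trans i<j (<-trans j<k k<)))
  ; fishburn      = λ i<j j< → fish (s≤s (s≤s i<j)) (s≤s (s≤s j<))
  }

-- The order of two entries of (a+1 … b) (2 … a−1) (b+1 … n): increasing, except that the
-- block (a, b] comes before the entries below a.
BlockOrder : ℕ → ℕ → ℕ → ℕ → Set
BlockOrder a b x y = (x < y × ¬ (x < a × a < y × y ≤ b)) ⊎ (y < a × a < x × x ≤ b)

blockOrder-admissible : ∀ {a b τ} → AllPairs (BlockOrder a b) τ → Admissible a τ
blockOrder-admissible {a} {b} {τ} ordered = record
  { avoids321     = λ i<j j<k k< → no321 (order i<j (<-trans j<k k<)) (order j<k k<)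
  ; avoids21Below = λ i<j j< → no21Below (order i<j j<)
  ; avoids132     = λ i<j j<k k< → no132 (order i<j (<-trans j<k k<)) (order j<k k<)
  ; fishburn      = λ i<j j< _ → noFishburn (order i<j j<)
  }
  where
  order : ∀ {i j} → i < j → j < length τ → BlockOrder a b (at τ i) (at τ j)
  order = AllPairs⇒at ordered
  no321 : ∀ {x y z} → BlockOrder a b x y → BlockOrder a b y z → z < y → y < x → ⊥
  no321 (inj₁ (x<y , _)) _                    _   y<x = <-asym x<y y<x
  no321 (inj₂ (y<a , _)) (inj₁ (y<z , _))     z<y _   = <-asym y<z z<y
  no321 (inj₂ (y<a , _)) (inj₂ (_ , a<y , _)) _   _   = <-asym y<a a<y
  no21Below : ∀ {x y} → BlockOrder a b x y → y < x → x < a → ⊥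
  no21Below (inj₁ (x<y , _))     y<x _   = <-asym x<y y<x
  no21Below (inj₂ (_ , a<x , _)) _   x<a = <-asym a<x x<a
  no132 : ∀ {x y z} → BlockOrder a b x y → BlockOrder a b y z → x < z → z < y → ⊥
  no132 _                     (inj₁ (y<z , _))         _   z<y = <-asym y<z z<y
  no132 (inj₁ (_ , ¬between)) (inj₂ (z<a , a<y , y≤b)) x<z _   =
    ¬between (<-trans x<z z<a , a<y , y≤b)
  no132 (inj₂ (y<a , _))      (inj₂ (_ , a<y , _))     _   _   = <-asym y<a a<y
  noFishburn : ∀ {x y} → BlockOrder a b x y → x ≡ y + 1 → ⊥
  noFishburn           (inj₁ (x<y , _))       refl = <⇒≱ x<y (m≤m+n _ 1)
  noFishburn {y = y}   (inj₂ (y<a , a<x , _)) refl = <⇒≱ a<x (subst (_≤ a) (+-comm 1 y) y<a)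

cons-admissible : ∀ {a c R} → a < c → AllPairs _<_ R → Any (_< c) R → Admissible a (c ∷ R)
cons-admissible {a} {c} {R} a<c R↑ below-c = record
  { avoids321     = λ { {j = suc j} {suc k} _ (s≤s j<k) (s≤s k<) c<b _ →
                          <-asym c<b (increasing j<k k<) }
  ; avoids21Below = λ { {zero}          _         _        _   c<a → <-asym a<c c<a
                      ; {suc i} {suc j} (s≤s i<j) (s≤s j<) b<c _   → <-asym b<c (increasing i<j j<) }
  ; avoids132     = λ { {j = suc j} {suc k} _ (s≤s j<k) (s≤s k<) _ c<b →
                          <-asym c<b (increasing j<k k<) }
  ; fishburn      = λ { {zero}          _         _        c<r _  → <-asym c<r (head<c R↑ below-c)
                      ; {suc i} {suc j} (s≤s i<j) (s≤s j<) _   eq →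
                          <-asym (increasing i<j j<) (subst (at R j <_) (sym eq) (m<m+n _ (s≤s z≤n))) }
  }
  where
  increasing : ∀ {i j} → i < j → j < length R → at R i < at R j
  increasing = AllPairs⇒at R↑
  head<c : ∀ {R} → AllPairs _<_ R → Any (_< c) R → at R 0 < c
  head<c _         (here r<c)    = r<c
  head<c (r<R ∷ _) (there below) = let _ , y∈ , y<c = find below in <-trans (lookup r<R y∈) y<c

-- The two families

data Shape : Set where
  A B : ℕ → ℕ → Shape

leading : Shape → ℕ
leading (A a _) = a
leading (B a _) = a

others : ℕ → ℕ → ℕ → List ℕ
others a c N = interval 2 a ++ interval (suc a) c ++ interval (suc c) (suc N)

body : ℕ → Shape → List ℕ
body N (A a m) = interval (suc a) (suc (a + m)) ++ interval 2 a ++ interval (suc (a + m)) (suc N)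
body N (B a c) = c ∷ others a c N

encode : ℕ → Shape → List ℕ
encode N p = leading p ∷ 1 ∷ body N p

bound : Shape → ℕ
bound (A a m) = a + m
bound (B a c) = c

-- For a = 2 the entries below a form an empty block, so every m gives the same word; m = 0 is
-- chosen.
WellFormed : Shape → Set
WellFormed (A a m) = 2 ≤ a × (a ≡ 2 → m ≡ 0)
WellFormed (B a c) = 2 ≤ a × suc a < c

others-increasing : ∀ {a c N} → a < c → AllPairs _<_ (others a c N)
others-increasing {a} {c} {N} a<c = AllPairs-++ (interval-increasing 2 a)
  (AllPairs-++ (interval-increasing (suc a) c) (interval-increasing (suc c) (suc N))
    λ x∈M y∈L → <-trans (proj₂ (∈-interval⁻ (suc a) c x∈M)) (proj₁ (∈-interval⁻ (suc c) (suc N) y∈L)))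
  λ x∈S y∈ML → <-trans (proj₂ (∈-interval⁻ 2 a x∈S)) (above-a (∈-++⁻ (interval (suc a) c) y∈ML))
  where
  above-a : ∀ {y} → y ∈ interval (suc a) c ⊎ y ∈ interval (suc c) (suc N) → a < y
  above-a (inj₁ y∈M) = proj₁ (∈-interval⁻ (suc a) c y∈M)
  above-a (inj₂ y∈L) = <-trans a<c (proj₁ (∈-interval⁻ (suc c) (suc N) y∈L))

∈-others⁻ : ∀ {a c N x} → 2 ≤ a → a < c → c ≤ N → x ∈ others a c N →
  2 ≤ x × x ≤ N × x ≢ a × x ≢ c
∈-others⁻ {a} {c} {N} 2≤a a<c c≤N x∈ with ∈-++⁻ (interval 2 a) x∈
... | inj₁ x∈S = let 2≤x , x<a = ∈-interval⁻ 2 a x∈S ; x<c = <-trans x<a a<c in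
  2≤x , ≤-trans (<⇒≤ x<c) c≤N , <⇒≢ x<a , <⇒≢ x<c
... | inj₂ x∈ML with ∈-++⁻ (interval (suc a) c) x∈ML
...   | inj₁ x∈M = let a<x , x<c = ∈-interval⁻ (suc a) c x∈M in
  ≤-trans 2≤a (<⇒≤ a<x) , ≤-trans (<⇒≤ x<c) c≤N , ≢-sym (<⇒≢ a<x) , <⇒≢ x<c
...   | inj₂ x∈L = let c<x , x<1+N = ∈-interval⁻ (suc c) (suc N) x∈L ; a<x = <-trans a<c c<x in
  ≤-trans 2≤a (<⇒≤ a<x) , ≤-pred x<1+N , ≢-sym (<⇒≢ a<x) , ≢-sym (<⇒≢ c<x)

∈-others⁺ : ∀ {a c N x} → 2 ≤ x → x ≤ N → x ≢ a → x ≢ c → x ∈ others a c N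
∈-others⁺ {a} {c} {N} {x} 2≤x x≤N x≢a x≢c with <-cmp x a
... | tri< x<a _ _   = ∈-++⁺ˡ (∈-interval⁺ 2≤x x<a)
... | tri≈ _ x≡a _   = ⊥-elim (x≢a x≡a)
... | tri> _ _ a<x with <-cmp x c
...   | tri< x<c _ _ = ∈-++⁺ʳ (interval 2 a) (∈-++⁺ˡ (∈-interval⁺ a<x x<c))
...   | tri≈ _ x≡c _ = ⊥-elim (x≢c x≡c)
...   | tri> _ _ c<x = ∈-++⁺ʳ (interval 2 a) (∈-++⁺ʳ (interval (suc a) c) (∈-interval⁺ c<x (s≤s x≤N)))

interval-1-around : ∀ {a N} → 2 ≤ a → a ≤ N →
  interval 1 (suc N) ≡ 1 ∷ interval 2 a ++ a ∷ interval (suc a) (suc N)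
interval-1-around {a} {N} 2≤a a≤N = begin
  interval 1 (suc N)                     ≡⟨ interval-∷ (s≤s (≤-trans (s≤s z≤n) (≤-trans 2≤a a≤N))) ⟩
  1 ∷ interval 2 (suc N)                 ≡⟨ cong (1 ∷_) (sym (interval-++ 2≤a (m≤n⇒m≤1+n a≤N))) ⟩
  1 ∷ interval 2 a ++ interval a (suc N) ≡⟨ cong (λ I → 1 ∷ interval 2 a ++ I) (interval-∷ (s≤s a≤N)) ⟩
  1 ∷ interval 2 a ++ a ∷ interval (suc a) (suc N) ∎
  where open ≡-Reasoning

encode-↭ : ∀ {N} p → WellFormed p → bound p ≤ N → encode N p ↭ interval 1 (suc N)
encode-↭ {N} (A a m) (2≤a , _) a+m≤N = ↭-sym (begin
  interval 1 (suc N)                    ≡⟨ interval-1-around 2≤a (≤-trans (m≤m+n a m) a+m≤N) ⟩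
  1 ∷ S ++ a ∷ interval (suc a) (suc N) ≡⟨ cong (λ I → 1 ∷ S ++ a ∷ I)
                                             (sym (interval-++ (s≤s (m≤m+n a m)) (s≤s a+m≤N))) ⟩
  1 ∷ S ++ a ∷ X ++ L                   ↭⟨ ↭-prep 1 (shift a S (X ++ L)) ⟩
  1 ∷ a ∷ S ++ X ++ L                   ↭⟨ ↭-swap 1 a ↭-refl ⟩
  a ∷ 1 ∷ S ++ X ++ L                   ↭⟨ ↭-prep a (↭-prep 1 (shifts S X)) ⟩
  a ∷ 1 ∷ X ++ S ++ L                   ∎)
  where
  open PermutationReasoning
  S X L : List ℕ
  S = interval 2 a
  X = interval (suc a) (suc (a + m))
  L = interval (suc (a + m)) (suc N)
encode-↭ {N} (B a c) (2≤a , a+1<c) c≤N = ↭-sym (begin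
  interval 1 (suc N)                    ≡⟨ interval-1-around 2≤a
                                             (≤-trans (<⇒≤ (<-trans (n<1+n a) a+1<c)) c≤N) ⟩
  1 ∷ S ++ a ∷ interval (suc a) (suc N) ≡⟨ cong (λ I → 1 ∷ S ++ a ∷ I)
                                             (sym (interval-++ (<⇒≤ a+1<c) (m≤n⇒m≤1+n c≤N))) ⟩
  1 ∷ S ++ a ∷ M ++ interval c (suc N)  ≡⟨ cong (λ I → 1 ∷ S ++ a ∷ M ++ I) (interval-∷ (s≤s c≤N)) ⟩
  1 ∷ S ++ a ∷ M ++ c ∷ L               ↭⟨ ↭-prep 1 (shift a S (M ++ c ∷ L)) ⟩
  1 ∷ a ∷ S ++ M ++ c ∷ L               ↭⟨ ↭-swap 1 a ↭-refl ⟩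
  a ∷ 1 ∷ S ++ M ++ c ∷ L               ≡⟨ cong (λ I → a ∷ 1 ∷ I) (sym (++-assoc S M (c ∷ L))) ⟩
  a ∷ 1 ∷ (S ++ M) ++ c ∷ L             ↭⟨ ↭-prep a (↭-prep 1 (shift c (S ++ M) L)) ⟩
  a ∷ 1 ∷ c ∷ (S ++ M) ++ L             ≡⟨ cong (λ I → a ∷ 1 ∷ c ∷ I) (++-assoc S M L) ⟩
  a ∷ 1 ∷ c ∷ S ++ M ++ L               ∎)
  where
  open PermutationReasoning
  S M L : List ℕ
  S = interval 2 a
  M = interval (suc a) c
  L = interval (suc c) (suc N)

body-admissible : ∀ {N} p → WellFormed p → bound p ≤ N → Admissible (leading p) (body N p)
body-admissible {N} (A a m) _ _ = blockOrder-admissible (AllPairs-++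
  (interval-AllPairs (suc a) (suc b) λ a<x x<y _ → inj₁ (x<y , λ (x<a , _) → <-asym a<x x<a))
  (AllPairs-++
    (interval-AllPairs 2 a λ _ x<y y<a → inj₁ (x<y , λ (_ , a<y , _) → <-asym a<y y<a))
    (interval-AllPairs (suc b) (suc N) λ b<x x<y _ →
      inj₁ (x<y , λ (_ , _ , y≤b) → <⇒≱ (<-trans b<x x<y) y≤b))
    λ x∈S y∈L → let x<a = proj₂ (∈-interval⁻ 2 a x∈S) ; b<y = proj₁ (∈-interval⁻ (suc b) (suc N) y∈L)
                in inj₁ (<-trans x<a (≤-<-trans (m≤m+n a m) b<y) , λ (_ , _ , y≤b) → <⇒≱ b<y y≤b))
  λ x∈X y∈SL → let a<x , x<1+b = ∈-interval⁻ (suc a) (suc b) x∈X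
               in block-first (∈-++⁻ (interval 2 a) y∈SL) a<x (≤-pred x<1+b))
  where
  b : ℕ
  b = a + m
  block-first : ∀ {x y} → y ∈ interval 2 a ⊎ y ∈ interval (suc b) (suc N) → a < x → x ≤ b →
    BlockOrder a b x y
  block-first (inj₁ y∈S) a<x x≤b = inj₂ (proj₂ (∈-interval⁻ 2 a y∈S) , a<x , x≤b)
  block-first (inj₂ y∈L) a<x x≤b = let b<y = proj₁ (∈-interval⁻ (suc b) (suc N) y∈L) in
    inj₁ (≤-<-trans x≤b b<y , λ (_ , _ , y≤b) → <⇒≱ b<y y≤b)
body-admissible {N} (B a c) (_ , a+1<c) _ = cons-admissible a<c (others-increasing a<c)
  (lose (∈-++⁺ʳ (interval 2 a) (∈-++⁺ˡ (∈-interval⁺ ≤-refl a+1<c))) a+1<c)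
  where
  a<c : a < c
  a<c = <-trans (n<1+n a) a+1<c

module _ {N} p (wf : WellFormed p) (p≤N : bound p ≤ N) where
  private
    ↭interval : encode N p ↭ interval 1 (suc N)
    ↭interval = encode-↭ p wf p≤N
    ∈-interval : ∀ {x} → x ∈ encode N p → 1 ≤ x × x < suc N
    ∈-interval x∈ = ∈-interval⁻ 1 (suc N) (∈-resp-↭ ↭interval x∈)

  length-encode : length (encode N p) ≡ N
  length-encode = trans (↭-length ↭interval) (length-interval 1 (suc N))

  encode-∈-words : encode N p ∈ words N N
  encode-∈-words = ∈-words⁺ N N length-encode (tabulate λ x∈ → letter (∈-interval x∈))
    where
    letter : ∀ {x} → 1 ≤ x × x < suc N → x ∈ applyUpTo suc N
    letter {suc i} (_ , s≤s i<N) = ∈-applyUpTo⁺ suc i<N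

  encode-good : Good (encode N p)
  encode-good = record
    { permutation = λ 1≤v v≤ → ∈-resp-↭ (↭-sym ↭interval)
                                 (∈-interval⁺ 1≤v (s≤s (subst (_ ≤_) length-encode v≤)))
    ; fishburn    = fishburn-∷∷ positive admissible
    ; avoids321   = avoids321-∷∷ positive admissible
    ; avoids1243  = avoids1243-∷∷ positive admissible
    ; second≡1    = refl
    }
    where
    positive : Positive (encode N p)
    positive t< = proj₁ (∈-interval (at-∈ _ t<))
    admissible : Admissible (leading p) (body N p)
    admissible = body-admissible p wf p≤N

-- Every good word belongs to one of the families

record GoodBody (a N : ℕ) (τ : List ℕ) : Set where
  field
    2≤a        : 2 ≤ a
    a≤N        : a ≤ N
    ∈⁻         : ∀ {x} → x ∈ τ → 2 ≤ x × x ≤ N × x ≢ a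
    ∈⁺         : ∀ {x} → 2 ≤ x → x ≤ N → x ≢ a → x ∈ τ
    distinct   : ∀ {i j} → i < j → j < length τ → at τ i ≢ at τ j
    admissible : Admissible a τ

  open Admissible admissible public

  compare : ∀ {i j} → i < j → j < length τ → at τ i < at τ j ⊎ at τ j < at τ i
  compare {i} {j} i<j j< with <-cmp (at τ i) (at τ j)
  ... | tri< lt _ _ = inj₁ lt
  ... | tri≈ _ eq _ = ⊥-elim (distinct i<j j< eq)
  ... | tri> _ _ gt = inj₂ gt

  ≮a⇒>a : ∀ {x} → x ∈ τ → ¬ x < a → a < x
  ≮a⇒>a x∈ x≮a = ≤∧≢⇒< (≮⇒≥ x≮a) (λ a≡x → proj₂ (proj₂ (∈⁻ x∈)) (sym a≡x))

module _ {a N τ} (facts : GoodBody a N τ) (head≤ : 0 < length τ → at τ 0 ≤ suc a) where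
  open GoodBody facts

  private
    small? : Decidable (_< a)
    small? = _<? a

  head<large : ∀ {j} → 0 < j → j < length τ → a < at τ j → at τ 0 < at τ j
  head<large 0<j j< a<τj = ≤∧≢⇒< (≤-trans (head≤ (<-trans 0<j j<)) a<τj) (distinct 0<j j<)

  large-increasing : ∀ {i j} → i < j → j < length τ → a < at τ i → a < at τ j → at τ i < at τ j
  large-increasing {zero}  i<j j< _ a<τj = head<large i<j j< a<τj
  large-increasing {suc i} i<j j< _ a<τj with compare i<j j<
  ... | inj₁ lt = lt
  ... | inj₂ gt =
    ⊥-elim (avoids132 {0} (s≤s z≤n) i<j j< (head<large (<-trans (s≤s z≤n) i<j) j< a<τj) gt)

  small-increasing : ∀ {i j} → i < j → j < length τ → at τ i < a → at τ j < a → at τ i < at τ j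
  small-increasing i<j j< τi<a _ with compare i<j j<
  ... | inj₁ lt = lt
  ... | inj₂ gt = ⊥-elim (avoids21Below i<j j< gt τi<a)

  no-small-large-small : ∀ {i j k} → i < j → j < k → k < length τ →
    at τ i < a → ¬ at τ j < a → at τ k < a → ⊥
  no-small-large-small i<j j<k k< τi<a τj≮a τk<a =
    avoids132 i<j j<k k< (small-increasing (<-trans i<j j<k) k< τi<a τk<a)
      (<-trans τk<a (≮a⇒>a (at-∈ τ (<-trans j<k k<)) τj≮a))

  filter-small≡interval : filter small? τ ≡ interval 2 a
  filter-small≡interval = increasing-≡
    (filter-increasing small? τ small-increasing) (interval-increasing 2 a)
    (λ x∈ → let x∈τ , x<a = ∈-filter⁻ small? {xs = τ} x∈ in ∈-interval⁺ (proj₁ (∈⁻ x∈τ)) x<a)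
    (λ x∈ → let 2≤x , x<a = ∈-interval⁻ 2 a x∈ in
      ∈-filter⁺ small? (∈⁺ 2≤x (≤-trans (<⇒≤ x<a) a≤N) (<⇒≢ x<a)) x<a)

  filter-large≡interval : filter (∁? small?) τ ≡ interval (suc a) (suc N)
  filter-large≡interval = increasing-≡
    (filter-increasing (∁? small?) τ λ i<j j< τi≮a τj≮a →
      large-increasing i<j j< (≮a⇒>a (at-∈ τ (<-trans i<j j<)) τi≮a) (≮a⇒>a (at-∈ τ j<) τj≮a))
    (interval-increasing (suc a) (suc N))
    (λ x∈ → let x∈τ , x≮a = ∈-filter⁻ (∁? small?) {xs = τ} x∈ in
      ∈-interval⁺ (≮a⇒>a x∈τ x≮a) (s≤s (proj₁ (proj₂ (∈⁻ x∈τ)))))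
    (λ x∈ → let a<x , x<1+N = ∈-interval⁻ (suc a) (suc N) x∈ in
      ∈-filter⁺ (∁? small?) (∈⁺ (≤-trans 2≤a (<⇒≤ a<x)) (≤-pred x<1+N) (≢-sym (<⇒≢ a<x)))
        (<⇒≱ a<x ∘ <⇒≤))

  low-head⇒encoded : ∃[ p ] WellFormed p × bound p ≤ N × a ∷ 1 ∷ τ ≡ encode N p
  low-head⇒encoded =
    let X , Z , τ≡ , XZ≡ = partition-sandwich small? τ no-small-large-small
    in from-sandwich X Z (trans τ≡ (cong (λ S → X ++ S ++ Z) filter-small≡interval))
                         (trans XZ≡ filter-large≡interval)
    where
    from-sandwich : ∀ X Z → τ ≡ X ++ interval 2 a ++ Z → X ++ Z ≡ interval (suc a) (suc N) →
      ∃[ p ] WellFormed p × bound p ≤ N × a ∷ 1 ∷ τ ≡ encode N p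
    from-sandwich X Z τ≡ XZ≡ with a ≟ 2
    ... | yes refl = A 2 0 , (≤-refl , λ _ → refl) , a≤N , cong (λ τ → 2 ∷ 1 ∷ τ) (trans τ≡ XZ≡)
    ... | no a≢2 =
      let X≡ , Z≡ = ++-injective-length {X} {Z} {interval (suc a) (suc (a + m))} |X|≡
                      (trans XZ≡ (sym (interval-++ (s≤s (m≤m+n a m)) (s≤s a+m≤N))))
      in A a m , (2≤a , ⊥-elim ∘ a≢2) , a+m≤N ,
         cong (λ τ → a ∷ 1 ∷ τ) (trans τ≡ (cong₂ (λ X Z → X ++ interval 2 a ++ Z) X≡ Z≡))
      where
      m : ℕ
      m = length X
      m≤N∸a : m ≤ N ∸ a
      m≤N∸a = ≤-trans (m≤m+n m (length Z)) (≤-reflexive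
        (trans (sym (length-++ X)) (trans (cong length XZ≡) (length-interval (suc a) (suc N)))))
      a+m≤N : a + m ≤ N
      a+m≤N = ≤-trans (+-monoʳ-≤ a m≤N∸a) (≤-reflexive (m+[n∸m]≡n a≤N))
      |X|≡ : length X ≡ length (interval (suc a) (suc (a + m)))
      |X|≡ = sym (trans (length-interval (suc a) (suc (a + m))) (m+n∸m≡n a m))

module _ {a N v R} (facts : GoodBody a N (suc v ∷ R)) (a<v : a < v) where
  open GoodBody facts

  private
    v∈R : v ∈ R
    v∈R with ∈⁺ (≤-trans 2≤a (<⇒≤ a<v)) (≤-trans (n≤1+n v) (proj₁ (proj₂ (∈⁻ (here refl)))))
                (≢-sym (<⇒≢ a<v))
    ... | here v≡1+v = ⊥-elim (<-irrefl v≡1+v (n<1+n v))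
    ... | there v∈   = v∈

  -- Since v = c − 1 occurs later, c < R₀ would be a Fishburn pattern.
  second<head : at R 0 < suc v
  second<head with q , q< , Rq≡v ← ∈⇒at v∈R with compare {0} {1} (s≤s z≤n) (s≤s (≤-<-trans z≤n q<))
  ... | inj₂ lt     = lt
  ... | inj₁ 1+v<R0 =
    ⊥-elim (fishburn {0} {suc q} (s≤s z≤n) (s≤s q<) 1+v<R0 (trans (cong suc (sym Rq≡v)) (+-comm 1 _)))

  -- A descent in R gives a 321 or a 132 through c or through R₀.
  tail-increasing : ∀ {i j} → i < j → j < length R → at R i < at R j
  tail-increasing {i} {j} i<j j< with compare (s≤s i<j) (s≤s j<)
  ... | inj₁ lt = lt
  ... | inj₂ Rj<Ri with compare {0} {suc i} (s≤s z≤n) (s≤s (<-trans i<j j<))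
  ...   | inj₂ Ri<c = ⊥-elim (avoids321 {0} (s≤s z≤n) (s≤s i<j) (s≤s j<) Rj<Ri Ri<c)
  ...   | inj₁ c<Ri with compare {0} {suc j} (s≤s z≤n) (s≤s j<)
  ...     | inj₁ c<Rj = ⊥-elim (avoids132 {0} (s≤s z≤n) (s≤s i<j) (s≤s j<) c<Rj Rj<Ri)
  ...     | inj₂ Rj<c with i
  ...       | zero  = ⊥-elim (<-asym c<Ri second<head)
  ...       | suc _ with compare {1} {suc j} (s≤s (≤-trans (s≤s z≤n) i<j)) (s≤s j<)
  ...         | inj₁ R0<Rj =
    ⊥-elim (avoids132 {1} (s≤s (s≤s z≤n)) (s≤s i<j) (s≤s j<) R0<Rj Rj<Ri)
  ...         | inj₂ Rj<R0 =
    ⊥-elim (avoids321 {0} (s≤s z≤n) (s≤s (≤-trans (s≤s z≤n) i<j)) (s≤s j<) Rj<R0 second<head)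

  high-head⇒tail≡others : R ≡ others a (suc v) N
  high-head⇒tail≡others = increasing-≡ (at⇒AllPairs R tail-increasing) (others-increasing {N = N} a<c)
    (λ x∈ → let 2≤x , x≤N , x≢a = ∈⁻ (there x∈) ; i , i< , Ri≡x = ∈⇒at x∈ in
       ∈-others⁺ 2≤x x≤N x≢a (λ x≡c → distinct {0} (s≤s z≤n) (s≤s i<) (sym (trans Ri≡x x≡c))))
    (λ x∈ → let 2≤x , x≤N , x≢a , x≢c = ∈-others⁻ 2≤a a<c (proj₁ (proj₂ (∈⁻ (here refl)))) x∈ in
       in-tail (∈⁺ 2≤x x≤N x≢a) x≢c)
    where
    a<c : a < suc v
    a<c = <-trans a<v (n<1+n v)
    in-tail : ∀ {x} → x ∈ suc v ∷ R → x ≢ suc v → x ∈ R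
    in-tail (here x≡c) x≢c = ⊥-elim (x≢c x≡c)
    in-tail (there x∈) _   = x∈

good-word-body : ∀ {N a τ} → (a ∷ 1 ∷ τ) ∈ words N N → Good (a ∷ 1 ∷ τ) → GoodBody a N τ
good-word-body {N} {a} {τ} w∈ good = record
  { 2≤a        = ≤∧≢⇒< (proj₁ (letter (here refl))) (≢-sym (distinct {0} {1} (s≤s z≤n) (s≤s (s≤s z≤n))))
  ; a≤N        = proj₂ (letter (here refl))
  ; ∈⁻         = λ x∈ → let t , t< , τt≡x = ∈⇒at x∈ in
                   subst (λ x → 2 ≤ x × x ≤ N × x ≢ a) τt≡x (value t<)
  ; ∈⁺         = λ 2≤x x≤N x≢a →
                   in-body (permutation (<⇒≤ 2≤x) (subst (_ ≤_) (sym |w|≡N) x≤N)) 2≤x x≢a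
  ; distinct   = λ i<j j< → distinct (s≤s (s≤s i<j)) (s≤s (s≤s j<))
  ; admissible = admissible-tail (λ t< → proj₁ (value t<)) avoids321 avoids1243 fishburn
  }
  where
  open Good good
  w : List ℕ
  w = a ∷ 1 ∷ τ
  |w|≡N : length w ≡ N
  |w|≡N = proj₁ (∈-words⁻ N N w∈)
  letter : ∀ {x} → x ∈ w → 1 ≤ x × x ≤ N
  letter x∈ with ∈-applyUpTo⁻ suc (lookup (proj₂ (∈-words⁻ N N w∈)) x∈)
  ... | i , i<N , refl = s≤s z≤n , i<N
  distinct : ∀ {i j} → i < j → j < length w → at w i ≢ at w j
  distinct = covering-distinct (increasing-unique (interval-increasing 1 (suc N)))
    (λ x∈ → let 1≤x , x<1+N = ∈-interval⁻ 1 (suc N) x∈ in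
      permutation 1≤x (subst (_ ≤_) (sym |w|≡N) (≤-pred x<1+N)))
    (≤-reflexive (trans |w|≡N (sym (length-interval 1 (suc N)))))
  value : ∀ {t} → t < length τ → 2 ≤ at τ t × at τ t ≤ N × at τ t ≢ a
  value t< = let 1≤x , x≤N = letter (there (there (at-∈ τ t<))) in
    ≤∧≢⇒< 1≤x (distinct {1} (s≤s (s≤s z≤n)) (s≤s (s≤s t<))) , x≤N ,
    ≢-sym (distinct {0} (s≤s z≤n) (s≤s (s≤s t<)))
  in-body : ∀ {x} → x ∈ w → 2 ≤ x → x ≢ a → x ∈ τ
  in-body (here x≡a)          _   x≢a = ⊥-elim (x≢a x≡a)
  in-body (there (here refl)) 2≤1 _   = ⊥-elim (<-irrefl refl 2≤1)
  in-body (there (there x∈))  _   _   = x∈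

good-body-encoded : ∀ {a N τ} → GoodBody a N τ →
  ∃[ p ] WellFormed p × bound p ≤ N × a ∷ 1 ∷ τ ≡ encode N p
good-body-encoded {a} {N} {[]}    facts = low-head⇒encoded facts (λ ())
good-body-encoded {a} {N} {c ∷ R} facts with c ≤? suc a
... | yes c≤1+a = low-head⇒encoded facts (λ _ → c≤1+a)
... | no  c≰1+a with c | ≰⇒> c≰1+a
...   | suc v | s≤s a<v = B a (suc v) , (GoodBody.2≤a facts , s≤s a<v) ,
        proj₁ (proj₂ (GoodBody.∈⁻ facts (here refl))) ,
        cong (λ R → a ∷ 1 ∷ suc v ∷ R) (high-head⇒tail≡others facts a<v)

good-word-encoded : ∀ {N w} → w ∈ words N N → Good w →
  ∃[ p ] WellFormed p × bound p ≤ N × w ≡ encode N p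
good-word-encoded {w = []}        _  good = ⊥-elim (0≢1+n (Good.second≡1 good))
good-word-encoded {w = _ ∷ []}    _  good = ⊥-elim (0≢1+n (Good.second≡1 good))
good-word-encoded {w = a ∷ b ∷ τ} w∈ good with refl ← Good.second≡1 good =
  good-body-encoded (good-word-body w∈ good)

-- Counting

blockLength : ℕ → List ℕ → ℕ
blockLength 2 _ = 0
blockLength a τ = length (takeWhile (a <?_) τ)

decode : List ℕ → Shape
decode (a ∷ _ ∷ c ∷ τ) with suc a <? c
... | yes _ = B a c
... | no  _ = A a (blockLength a (c ∷ τ))
decode (a ∷ _) = A a 0
decode []      = A 0 0

decode-low-head : ∀ {a b c} τ → c ≤ suc a → decode (a ∷ b ∷ c ∷ τ) ≡ A a (blockLength a (c ∷ τ))
decode-low-head {a} {c = c} _ c≤1+a with suc a <? c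
... | yes a+1<c = contradiction c≤1+a (<⇒≱ a+1<c)
... | no  _     = refl

decode-encode : ∀ {N} p → WellFormed p → bound p ≤ N → decode (encode N p) ≡ p
decode-encode (B a c) (_ , a+1<c) _ with suc a <? c
... | yes _     = refl
... | no  a+1≮c = contradiction a+1<c a+1≮c
decode-encode (A 0 _) (() , _) _
decode-encode (A 1 _) (s≤s () , _) _
decode-encode {zero}              (A 2 _) _ ()
decode-encode {suc zero}          (A 2 _) _ (s≤s ())
decode-encode {suc (suc zero)}    (A 2 m) (_ , 2⇒m≡0) _ with refl ← 2⇒m≡0 refl = refl
decode-encode {suc (suc (suc N))} (A 2 m) (_ , 2⇒m≡0) _ with refl ← 2⇒m≡0 refl = refl
decode-encode {N} (A a@(suc (suc (suc a′))) m) _ _ rewrite interval-+ (suc a) m with m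
... | zero   = refl
... | suc m′ = trans (decode-low-head {a} {1} {suc a} (iterate suc (suc (suc a)) m′ ++ 2 ∷ Y) ≤-refl)
                     (cong (A a) (begin
  length (takeWhile (a <?_) (X ++ 2 ∷ Y)) ≡⟨ cong length (takeWhile-++ (a <?_) (2 ∷ Y) above) ⟩
  length (X ++ takeWhile (a <?_) (2 ∷ Y)) ≡⟨ cong (λ T → length (X ++ T)) (takeWhile-reject (a <?_) Y
                                                (λ a<2 → <⇒≱ a<2 (s≤s (s≤s z≤n)))) ⟩
  length (X ++ [])                        ≡⟨ cong length (++-identityʳ X) ⟩
  length X                                ≡⟨ length-iterate suc (suc a) (suc m′) ⟩
  suc m′                                  ∎))
  where
  open ≡-Reasoning
  X Y : List ℕ
  X = iterate suc (suc a) (suc m′)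
  Y = iterate suc 3 a′ ++ interval (suc (a + suc m′)) (suc N)
  above : All (a <_) X
  above = tabulate (λ x∈ → proj₁ (∈-iterate-suc⁻ (suc a) (suc m′) x∈))

withBound : ℕ → List Shape
withBound 2 = A 2 0 ∷ []
withBound b = map (λ a → A a (b ∸ a)) (interval 3 (suc b)) ++ map (λ a → B a b) (interval 2 (b ∸ 1))

shapes : ℕ → List Shape
shapes zero    = []
shapes (suc N) = shapes N ++ withBound (suc N)

2≤bound : ∀ {p} → WellFormed p → 2 ≤ bound p
2≤bound {A a m} (2≤a , _)     = ≤-trans 2≤a (m≤m+n a m)
2≤bound {B a c} (2≤a , a+1<c) = ≤-trans 2≤a (<⇒≤ (<-trans (n<1+n a) a+1<c))

∈-withBound⁻ : ∀ {b p} → p ∈ withBound b → WellFormed p × bound p ≡ b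
∈-withBound⁻ {0} ()
∈-withBound⁻ {1} ()
∈-withBound⁻ {2} (here refl) = (≤-refl , λ _ → refl) , refl
∈-withBound⁻ {b@(suc (suc (suc _)))} p∈ with ∈-++⁻ (map (λ a → A a (b ∸ a)) (interval 3 (suc b))) p∈
... | inj₁ p∈A =
  let a , a∈ , p≡ = ∈-map⁻ (λ a → A a (b ∸ a)) p∈A ; 3≤a , a<1+b = ∈-interval⁻ 3 (suc b) a∈
  in subst (λ p → WellFormed p × bound p ≡ b) (sym p≡)
       ((≤-trans (n≤1+n 2) 3≤a , λ a≡2 → ⊥-elim (<-irrefl refl (subst (3 ≤_) a≡2 3≤a))) ,
        m+[n∸m]≡n (≤-pred a<1+b))
... | inj₂ p∈B =
  let a , a∈ , p≡ = ∈-map⁻ (λ a → B a b) p∈B ; 2≤a , a<b∸1 = ∈-interval⁻ 2 (b ∸ 1) a∈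
  in subst (λ p → WellFormed p × bound p ≡ b) (sym p≡) ((2≤a , s≤s a<b∸1) , refl)

∈-withBound⁺ : ∀ {p} → WellFormed p → p ∈ withBound (bound p)
∈-withBound⁺ {A 0 _} (() , _)
∈-withBound⁺ {A 1 _} (s≤s () , _)
∈-withBound⁺ {A 2 m} (_ , 2⇒m≡0) with refl ← 2⇒m≡0 refl = here refl
∈-withBound⁺ {A a@(suc (suc (suc _))) m} _ =
  ∈-++⁺ˡ (subst (_∈ map (λ x → A x (a + m ∸ x)) (interval 3 (suc (a + m)))) (cong (A a) (m+n∸m≡n a m))
           (∈-map⁺ (λ x → A x (a + m ∸ x)) (∈-interval⁺ (s≤s (s≤s (s≤s z≤n))) (s≤s (m≤m+n a m)))))
∈-withBound⁺ {B _ 0} (_ , ())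
∈-withBound⁺ {B _ 1} (_ , s≤s ())
∈-withBound⁺ {B _ 2} (s≤s (s≤s _) , s≤s (s≤s ()))
∈-withBound⁺ {B a c@(suc (suc (suc _)))} (2≤a , s≤s a<c∸1) =
  ∈-++⁺ʳ (map (λ x → A x (c ∸ x)) (interval 3 (suc c))) (∈-map⁺ (λ x → B x c) (∈-interval⁺ 2≤a a<c∸1))

∈-shapes⁻ : ∀ {N p} → p ∈ shapes N → WellFormed p × bound p ≤ N
∈-shapes⁻ {suc N} p∈ with ∈-++⁻ (shapes N) p∈
... | inj₁ p∈old = let wf , p≤N = ∈-shapes⁻ p∈old in wf , m≤n⇒m≤1+n p≤N
... | inj₂ p∈new = let wf , p≡ = ∈-withBound⁻ p∈new in wf , ≤-reflexive p≡

∈-shapes⁺ : ∀ {N p} → WellFormed p → bound p ≤ N → p ∈ shapes N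
∈-shapes⁺ {zero}      wf p≤0 = contradiction (≤-trans (2≤bound wf) p≤0) λ ()
∈-shapes⁺ {suc N} {p} wf p≤1+N with m≤n⇒m<n∨m≡n p≤1+N
... | inj₁ p<1+N = ∈-++⁺ˡ (∈-shapes⁺ wf (≤-pred p<1+N))
... | inj₂ p≡1+N = ∈-++⁺ʳ (shapes N) (subst (λ b → p ∈ withBound b) p≡1+N (∈-withBound⁺ wf))

withBound-unique : ∀ b → Unique (withBound b)
withBound-unique 0 = []
withBound-unique 1 = []
withBound-unique 2 = All.[] ∷ []
withBound-unique b@(suc (suc (suc _))) = Unique.++⁺
  (Unique.map⁺ (λ { refl → refl }) (increasing-unique (interval-increasing 3 (suc b))))
  (Unique.map⁺ (λ { refl → refl }) (increasing-unique (interval-increasing 2 (b ∸ 1))))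
  λ (p∈A , p∈B) → let _ , _ , p≡A = ∈-map⁻ _ p∈A ; _ , _ , p≡B = ∈-map⁻ _ p∈B
                  in A≢B (trans (sym p≡A) p≡B)
  where
  A≢B : ∀ {a m a′ c} → A a m ≢ B a′ c
  A≢B ()

shapes-unique : ∀ N → Unique (shapes N)
shapes-unique zero    = []
shapes-unique (suc N) = Unique.++⁺ (shapes-unique N) (withBound-unique (suc N))
  λ (p∈old , p∈new) → 1+n≰n (subst (_≤ N) (proj₂ (∈-withBound⁻ p∈new)) (proj₂ (∈-shapes⁻ p∈old)))

shapes-length : ∀ n → length (shapes (2 + n)) ≡ 1 + n * n
shapes-length zero    = refl
shapes-length (suc n) = begin
  length (shapes (2 + n) ++ withBound (3 + n))
    ≡⟨ length-++ (shapes (2 + n)) ⟩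
  length (shapes (2 + n)) + length (withBound (3 + n))
    ≡⟨ cong₂ _+_ (shapes-length n) (length-++ (map _ (interval 3 (4 + n)))) ⟩
  1 + n * n + (length (map _ (interval 3 (4 + n))) + length (map _ (interval 2 (2 + n))))
    ≡⟨ cong₂ (λ x y → 1 + n * n + (x + y))
         (trans (length-map _ (interval 3 (4 + n))) (length-interval 3 (4 + n)))
         (trans (length-map _ (interval 2 (2 + n))) (length-interval 2 (2 + n))) ⟩
  1 + n * n + (suc n + n)
    ≡⟨ square-step n ⟩
  1 + suc n * suc n
    ∎
  where
  open ≡-Reasoning
  square-step : ∀ n → 1 + n * n + (suc n + n) ≡ 1 + suc n * suc n
  square-step = solve-∀

encodings-unique : ∀ N → Unique (map (encode N) (shapes N))
encodings-unique N = Unique.map⁻ {f = decode} (subst Unique (sym decode∘encode≡id) (shapes-unique N))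
  where
  decode∘encode≡id : map decode (map (encode N) (shapes N)) ≡ shapes N
  decode∘encode≡id = trans (sym (map-∘ (shapes N))) (map-id-local (All.tabulate λ p∈ →
    let wf , p≤N = ∈-shapes⁻ p∈ in decode-encode _ wf p≤N))

count≡length-shapes : ∀ N → count N ≡ length (shapes N)
count≡length-shapes N = trans
  (↭-length (↭-of-same-elements (Unique.filter⁺ good? (words-unique N N)) (encodings-unique N)
                                good⇒encoded encoded⇒good))
  (length-map (encode N) (shapes N))
  where
  good? : Decidable (T ∘ good)
  good? w = T? (good w)
  good⇒encoded : ∀ {w} → w ∈ filter good? (words N N) → w ∈ map (encode N) (shapes N)
  good⇒encoded w∈ =
    let w∈words , good-w   = ∈-filter⁻ good? {xs = words N N} w∈
        p , wf , p≤N , w≡ = good-word-encoded w∈words (good⇒Good _ good-w)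
    in subst (_∈ map (encode N) (shapes N)) (sym w≡) (∈-map⁺ (encode N) (∈-shapes⁺ wf p≤N))
  encoded⇒good : ∀ {w} → w ∈ map (encode N) (shapes N) → w ∈ filter good? (words N N)
  encoded⇒good w∈ =
    let p , p∈ , w≡ = ∈-map⁻ (encode N) w∈ ; wf , p≤N = ∈-shapes⁻ p∈
    in subst (_∈ filter good? (words N N)) (sym w≡)
         (∈-filter⁺ good? (encode-∈-words p wf p≤N) (Good⇒good _ (encode-good p wf p≤N)))

proposition2p3 : (n : ℕ) → 2 ≤ n → count n + 4 * n ≡ n * n + 5
proposition2p3 (suc zero)    (s≤s ())
proposition2p3 (suc (suc n)) _ = begin
  count (2 + n) + 4 * (2 + n)           ≡⟨ cong (_+ 4 * (2 + n)) (count≡length-shapes (2 + n)) ⟩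
  length (shapes (2 + n)) + 4 * (2 + n) ≡⟨ cong (_+ 4 * (2 + n)) (shapes-length n) ⟩
  1 + n * n + 4 * (2 + n)               ≡⟨ arithmetic n ⟩
  (2 + n) * (2 + n) + 5                 ∎
  where
  open ≡-Reasoning
  arithmetic : ∀ n → 1 + n * n + 4 * (2 + n) ≡ (2 + n) * (2 + n) + 5
  arithmetic = solve-∀
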